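{- Let $m\ge 3$ be an integer and let $R_m$ be the hypergraph whose vertex set is $S=\{1,2,\dots,m(m-2)\}$ and whose edges are all subsets of $S$ of cardinality $m-2$. Then $n_m$ equals the minimum, over all sub-hypergraphs $R'$ of $R_m$ with exactly $m$ edges, of $cov_{R_m}(T(R'))$.
   Context: For a graph $G$, a $k$-list assignment $L$ assigns to each vertex $v$ a set $L(v)$ of exactly $k$ colors; a proper $L$-coloring chooses $c(v)\in L(v)$ for each $v$ with adjacent vertices receiving different colors; $ch(G)$ is the least $k$ such that every $k$-list assignment of $G$ admits a proper $L$-coloring. $n_m$ is the smallest positive integer $n$ with $ch(K_{m,n})=m-1$. A hypergraph is a pair $(V,E)$ with $E$ a set of subsets of $V$ (all finite). A transversal of a family of sets $\mathcal S$ is a set meeting every member of $\mathcal S$. The transversal hypergraph $T(\mathcal S)$ has as vertices the union of the sets in $\mathcal S$ and as edges all transversals of $\mathcal S$ of cardinality at most $|\mathcal S|$; for a hypergraph $R'$, $T(R')$ is the transversal hypergraph of its edge set. For hypergraphs $R,H$, an $R$-cover of $H$ is a sub-hypergraph $C$ of $R$ such that every edge of $H$ contains at least one edge of $C$; $cov_R(H)$ is the minimum number of edges of an $R$-cover of $H$, and $cov_R(H)=\infty$ if none exists. -}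

module Defs where

open import Data.Nat using (ℕ; _≤_; _∸_; _*_)
open import Data.Fin using (Fin)
open import Data.Fin.Subset using (Subset; _⊆_; _∩_; ⋃; ∣_∣; Nonempty)
open import Data.List using (List; length; tabulate)
open import Data.List.Membership.Propositional using (_∈_)
open import Data.List.Relation.Unary.Unique.Propositional using (Unique)
open import Data.Sum using (_⊎_; inj₁; inj₂)
open import Data.Product using (Σ; ∃; ∃-syntax; _×_; _,_; proj₁)
open import Data.Unit using (⊤)
open import Data.Empty using (⊥)
open import Function.Definitions using (Injective)
open import Relation.Binary.PropositionalEquality using (_≡_; _≢_)

record Graph : Set₁ where
  field
    V   : Set
    Adj : V → V → Set
open Graph public

K : ℕ → ℕ → Graph
K m n = record { V = Fin m ⊎ Fin n ; Adj = adj }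
  where
  adj : Fin m ⊎ Fin n → Fin m ⊎ Fin n → Set
  adj (inj₁ _) (inj₂ _) = ⊤
  adj (inj₂ _) (inj₁ _) = ⊤
  adj _ _ = ⊥

-- colours are natural numbers; a list L(v) is a duplicate-free list
-- of exactly k colours (i.e. a k-element set of colours)
ListAssignment : Graph → ℕ → Set
ListAssignment G k =
  Σ (V G → List ℕ) λ L → (∀ v → Unique (L v)) × (∀ v → length (L v) ≡ k)

ProperLColoring : (G : Graph) {k : ℕ} → ListAssignment G k → Set
ProperLColoring G (L , _) =
  Σ (V G → ℕ) λ c → (∀ v → c v ∈ L v) × (∀ u v → Adj G u v → c u ≢ c v)

Choosable : Graph → ℕ → Set
Choosable G k = (L : ListAssignment G k) → ProperLColoring G L

ChIs : Graph → ℕ → Set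
ChIs G k = Choosable G k × (∀ k′ → Choosable G k′ → k ≤ k′)

-- n is n_m : smallest positive n with ch(K_{m,n}) = m - 1
IsNm : ℕ → ℕ → Set
IsNm m n = 1 ≤ n × ChIs (K m n) (m ∸ 1)
         × (∀ n′ → 1 ≤ n′ → ChIs (K m n′) (m ∸ 1) → n ≤ n′)

Hypergraph : ℕ → Set₁
Hypergraph N = Subset N → Set

Complete : (N r : ℕ) → Hypergraph N
Complete N r e = ∣ e ∣ ≡ r

SubFamily : {N : ℕ} → Hypergraph N → ℕ → Set
SubFamily {N} R k =
  Σ (Fin k → Subset N) λ E → Injective _≡_ _≡_ E × (∀ i → R (E i))

-- transversal hypergraph T(R') of a family with k edges:
-- vertices = union of the edges, edges = transversals of size ≤ k
T : {N k : ℕ} → (Fin k → Subset N) → Hypergraph N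
T {N} {k} E t = t ⊆ ⋃ (tabulate E) × (∀ i → Nonempty (t ∩ E i)) × ∣ t ∣ ≤ k

Cover : {N : ℕ} → Hypergraph N → Hypergraph N → ℕ → Set
Cover {N} R H c =
  Σ (SubFamily R c) λ C → ∀ e → H e → ∃[ i ] (proj₁ C i ⊆ e)

CovIs : {N : ℕ} → Hypergraph N → Hypergraph N → ℕ → Set
CovIs R H c = Cover R H c × (∀ c′ → Cover R H c′ → c ≤ c′)

Rm : (m : ℕ) → Hypergraph (m * (m ∸ 2))
Rm m = Complete (m * (m ∸ 2)) (m ∸ 2)

MinCovIs : ℕ → ℕ → Set
MinCovIs m n =
  (Σ (SubFamily (Rm m) m) λ R′ → CovIs (Rm m) (T (proj₁ R′)) n)
  × (∀ (R′ : SubFamily (Rm m) m) c → CovIs (Rm m) (T (proj₁ R′)) c → n ≤ c)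

{-# OPTIONS --safe #-}
module Submission where

open import Defs
open import Data.Nat using (ℕ; zero; suc; _+_; _*_; _∸_; _≤_; _<_; _≤′_; ≤′-refl; ≤′-step; z≤n; s≤s; _≟_; _≤?_; NonZero; >-nonZero⁻¹)
open import Data.Nat.Properties as ℕ using (≤-refl; ≤-trans; ≤-reflexive)
open import Data.Nat.DivMod using (_mod_; _%_; m<n⇒m%n≡m)
open import Data.Bool.Properties as Bool using ()
open import Data.Fin as F using (Fin; zero; suc; toℕ)
open import Data.Fin.Properties as FP using (all?)
open import Data.Fin.Subset using (Subset; inside; outside; _∈_; _∉_; _⊆_; _⊈_; _∪_; _∩_; ⋃; ⁅_⁆; ∣_∣; Nonempty)
open import Data.Fin.Subset.Properties as SP using (_∈?_; _⊆?_; nonempty?; anySubset?)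
open import Data.Vec using ([]; _∷_; here; there)
open import Data.Vec.Properties as Vec using ()
open import Data.Vec.Functional as Vector using (head; tail)
open import Data.List as L using (List; []; _∷_; length; map; tabulate; filter; allFin; lookup; deduplicate)
open import Data.List.Properties as LP using (length-map; length-tabulate)
open import Data.List.Extrema.Nat using (max; xs≤max)
open import Data.List.Membership.Propositional using (find) renaming (_∈_ to _∈ₗ_; _∉_ to _∉ₗ_)
open import Data.List.Membership.Propositional.Properties as ∈ₗ using ()
open import Data.List.Relation.Binary.Subset.Propositional using () renaming (_⊆_ to _⊆ₗ_)
open import Data.List.Relation.Binary.Subset.Propositional.Properties using () renaming (⊆-refl to ⊆ₗ-refl; ⊆-trans to ⊆ₗ-trans)
open import Data.List.Relation.Binary.Subset.DecPropositional _≟_ using () renaming (_⊆?_ to _⊆ₗ?_)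
open import Data.List.Relation.Unary.All as All using (All; []; _∷_)
open import Data.List.Relation.Unary.All.Properties as AllP using ()
open import Data.List.Relation.Unary.AllPairs using ([]; _∷_)
open import Data.List.Relation.Unary.Any as Any using (Any; here; there)
open import Data.List.Relation.Unary.Any.Properties as AnyP using ()
open import Data.List.Relation.Unary.Unique.Propositional using (Unique)
open import Data.List.Relation.Unary.Unique.Propositional.Properties as Unique using ()
open import Data.List.Relation.Unary.Unique.DecPropositional.Properties using (deduplicate-!)
open import Data.Product using (Σ; ∃; ∃-syntax; _×_; _,_; proj₁; proj₂)
open import Data.Sum as Sum using (_⊎_; inj₁; inj₂)
open import Data.Empty using (⊥; ⊥-elim)
open import Data.Unit using (tt)
open import Function using (_∘_)
open import Function.Definitions using (Injective)
open import Relation.Nullary using (¬_; Dec; yes; no)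
open import Relation.Nullary.Decidable using (map′; _×-dec_; _→-dec_; ¬?; decidable-stable)
open import Relation.Unary using (Decidable)
open import Relation.Binary.Definitions using (_Respects_; DecidableEquality)
open import Relation.Binary.PropositionalEquality using (_≡_; _≢_; _≗_; refl; sym; trans; cong; cong₂; subst; module ≡-Reasoning)

-- Write k = m − 2 and N = m k, and let n be the least c such that some m distinct k-subsets E
-- of Fin N have T(E) covered by c k-subsets (TCoverable N k m c).
--
-- K_{m,n} is not k-choosable: give the small side the edges of such an E and the large side
-- those of the cover. The colours chosen on the small side form a transversal of E, which
-- contains some edge of the cover, so the large vertex carrying that edge has no colour left.
--
-- K_{m,n′} is k-choosable for n′ < n: after making the small-side lists distinct sets, rename
-- their at most N colours into Fin N to get a family E, and turn the large-side lists inside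
-- those colours into at most n′ k-subsets. By minimality of n these do not cover T(E), and a
-- transversal escaping all of them colours the small side so that every large list keeps a
-- free colour.
--
-- So K_{m,n} is (k+1)-choosable, K_{m,n−1} being k-choosable, and ch(K_{m,n}) = m − 1 first
-- happens at n. The least n exists constructively because all the predicates involved are
-- decidable by exhaustive search.

private variable
  n N m : ℕ
  x : Fin n
  p : Subset n
  xs : List (Fin n)

-- Subsets of Fin n and lists of their elements

fromList : List (Fin n) → Subset n
fromList xs = ⋃ (map ⁅_⁆ xs)

∈-fromList⁺ : x ∈ₗ xs → x ∈ fromList xs
∈-fromList⁺ (here refl) = SP.x∈p∪q⁺ (inj₁ (SP.x∈⁅x⁆ _))
∈-fromList⁺ (there x∈) = SP.x∈p∪q⁺ (inj₂ (∈-fromList⁺ x∈))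

∈-fromList⁻ : ∀ xs → x ∈ fromList xs → x ∈ₗ xs
∈-fromList⁻ [] x∈ = ⊥-elim (SP.∉⊥ x∈)
∈-fromList⁻ (y ∷ ys) x∈ with SP.x∈p∪q⁻ ⁅ y ⁆ (fromList ys) x∈
... | inj₁ x∈⁅y⁆ = here (SP.x∈⁅y⁆⇒x≡y y x∈⁅y⁆)
... | inj₂ x∈ys = there (∈-fromList⁻ ys x∈ys)

∣⁅x⁆∪p∣≤1+∣p∣ : ∀ (x : Fin n) p → ∣ ⁅ x ⁆ ∪ p ∣ ≤ suc ∣ p ∣
∣⁅x⁆∪p∣≤1+∣p∣ zero (s ∷ p) rewrite SP.∪-identityˡ p = s≤s (SP.∣p∣≤∣x∷p∣ s p)
∣⁅x⁆∪p∣≤1+∣p∣ (suc x) (inside ∷ p) = s≤s (∣⁅x⁆∪p∣≤1+∣p∣ x p)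
∣⁅x⁆∪p∣≤1+∣p∣ (suc x) (outside ∷ p) = ∣⁅x⁆∪p∣≤1+∣p∣ x p

x∉p⇒∣⁅x⁆∪p∣≡1+∣p∣ : ∀ (x : Fin n) p → x ∉ p → ∣ ⁅ x ⁆ ∪ p ∣ ≡ suc ∣ p ∣
x∉p⇒∣⁅x⁆∪p∣≡1+∣p∣ zero (inside ∷ p) x∉p = ⊥-elim (x∉p here)
x∉p⇒∣⁅x⁆∪p∣≡1+∣p∣ zero (outside ∷ p) _ rewrite SP.∪-identityˡ p = refl
x∉p⇒∣⁅x⁆∪p∣≡1+∣p∣ (suc x) (inside ∷ p) x∉p = cong suc (x∉p⇒∣⁅x⁆∪p∣≡1+∣p∣ x p (x∉p ∘ there))
x∉p⇒∣⁅x⁆∪p∣≡1+∣p∣ (suc x) (outside ∷ p) x∉p = x∉p⇒∣⁅x⁆∪p∣≡1+∣p∣ x p (x∉p ∘ there)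

∣fromList∣≤length : ∀ (xs : List (Fin n)) → ∣ fromList xs ∣ ≤ length xs
∣fromList∣≤length {n} [] = ≤-reflexive (SP.∣⊥∣≡0 n)
∣fromList∣≤length (x ∷ xs) = ≤-trans (∣⁅x⁆∪p∣≤1+∣p∣ x _) (s≤s (∣fromList∣≤length xs))

∣fromList∣≡length : ∀ {xs : List (Fin n)} → Unique xs → ∣ fromList xs ∣ ≡ length xs
∣fromList∣≡length {n} {[]} [] = SP.∣⊥∣≡0 n
∣fromList∣≡length {xs = x ∷ xs} (x∉xs ∷ xs!) =
  trans (x∉p⇒∣⁅x⁆∪p∣≡1+∣p∣ x _ (λ x∈ → All.lookup x∉xs (∈-fromList⁻ xs x∈) refl))
        (cong suc (∣fromList∣≡length xs!))

∈-⋃⁺ : ∀ {ps : List (Subset n)} → Any (x ∈_) ps → x ∈ ⋃ ps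
∈-⋃⁺ (here x∈p) = SP.x∈p∪q⁺ (inj₁ x∈p)
∈-⋃⁺ (there x∈ps) = SP.x∈p∪q⁺ (inj₂ (∈-⋃⁺ x∈ps))

nonempty : (p : Subset n) → 1 ≤ ∣ p ∣ → Nonempty p
nonempty (inside ∷ p) _ = zero , here
nonempty (outside ∷ p) 1≤∣p∣ = let (x , x∈p) = nonempty p 1≤∣p∣ in suc x , there x∈p

elements : Subset n → List (Fin n)
elements p = filter (_∈? p) (allFin _)

∈-elements⁺ : x ∈ p → x ∈ₗ elements p
∈-elements⁺ x∈p = ∈ₗ.∈-filter⁺ (_∈? _) (∈ₗ.∈-allFin _) x∈p

∈-elements⁻ : x ∈ₗ elements p → x ∈ p
∈-elements⁻ {p = p} x∈ = proj₂ (∈ₗ.∈-filter⁻ (_∈? p) {xs = allFin _} x∈)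

elements-unique : (p : Subset n) → Unique (elements p)
elements-unique {n} p = Unique.filter⁺ (_∈? p) {allFin n} (Unique.allFin⁺ n)

fromList-elements : (p : Subset n) → fromList (elements p) ≡ p
fromList-elements p =
  SP.⊆-antisym (∈-elements⁻ ∘ ∈-fromList⁻ (elements p)) (∈-fromList⁺ ∘ ∈-elements⁺)

length-elements : (p : Subset n) → length (elements p) ≡ ∣ p ∣
length-elements p =
  trans (sym (∣fromList∣≡length (elements-unique p))) (cong ∣_∣ (fromList-elements p))

subsets : ∀ n → List (Subset n)
subsets zero = [] ∷ []
subsets (suc n) = map (inside ∷_) (subsets n) L.++ map (outside ∷_) (subsets n)

∈-subsets : ∀ (p : Subset n) → p ∈ₗ subsets n
∈-subsets [] = here refl
∈-subsets (inside ∷ p) = ∈ₗ.∈-++⁺ˡ (∈ₗ.∈-map⁺ (inside ∷_) (∈-subsets p))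
∈-subsets {suc n} (outside ∷ p) =
  ∈ₗ.∈-++⁺ʳ (map (inside ∷_) (subsets n)) (∈ₗ.∈-map⁺ (outside ∷_) (∈-subsets p))

_≟ₛ_ : DecidableEquality (Subset n)
_≟ₛ_ = Vec.≡-dec Bool._≟_

-- Exhaustive search

Searchable : Set → Set₁
Searchable A = ∀ {P : A → Set} → Decidable P → Dec (∃ P)

search-Fin→ : ∀ {A} → Searchable A → ∀ n {P : (Fin n → A) → Set} →
              P Respects _≗_ → Decidable P → Dec (∃ P)
search-Fin→ {A} search zero resp P? = map′ (empty ,_) (λ (f , p) → resp (λ ()) p) (P? empty)
  where
  empty : Fin 0 → A
  empty ()
search-Fin→ search (suc n) resp P? =
  map′ (λ (a , f , p) → a Vector.∷ f , p)
       (λ (f , p) → head f , tail f , resp (λ { zero → refl ; (suc i) → refl }) p)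
       (search λ a → search-Fin→ search n (λ f≗g → resp (λ { zero → refl ; (suc i) → f≗g i }))
                                           (P? ∘ (a Vector.∷_)))

injective? : ∀ {A : Set} {c} → DecidableEquality A → (f : Fin c → A) → Dec (Injective _≡_ _≡_ f)
injective? _≟_ f = map′ (λ h → h _ _) (λ h _ _ → h) (all? λ i → all? λ j → (f i ≟ f j) →-dec (i F.≟ j))

minimalFin : {P : Fin n → Set} → Decidable P → ∀ {i} → P i →
             ∃ λ f → P f × ∀ j → P j → toℕ f ≤ toℕ j
minimalFin {suc n} P? {i} pi with P? zero
... | yes p0 = zero , p0 , λ _ _ → z≤n
minimalFin {suc n} P? {zero} p0 | no ¬p0 = ⊥-elim (¬p0 p0)
minimalFin {suc n} P? {suc i} pi | no ¬p0 =
  let (f , pf , least) = minimalFin (P? ∘ suc) pi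
  in suc f , pf , λ { zero p0 → ⊥-elim (¬p0 p0) ; (suc j) pj → s≤s (least j pj) }

minimalℕ : {P : ℕ → Set} → Decidable P → ∀ {b} → P b → ∃ λ n → P n × ∀ c → P c → n ≤ c
minimalℕ {P} P? {b} pb =
  let (f , pf , least) = minimalFin (P? ∘ toℕ) {F.fromℕ b} (subst P (sym (FP.toℕ-fromℕ b)) pb)
  in toℕ f , pf , below f least
  where
  below : (f : Fin (suc b)) → (∀ j → P (toℕ j) → toℕ f ≤ toℕ j) → ∀ c → P c → toℕ f ≤ c
  below f least c pc with c ≤? b
  ... | yes c≤b = subst (toℕ f ≤_) (FP.toℕ-fromℕ< (s≤s c≤b))
                    (least _ (subst P (sym (FP.toℕ-fromℕ< (s≤s c≤b))) pc))
  ... | no c≰b = ≤-trans (ℕ.≤-pred (FP.toℕ<n f)) (ℕ.<⇒≤ (ℕ.≰⇒> c≰b))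

-- Lists of colours

lookup-injective : ∀ {A : Set} {xs : List A} → Unique xs →
                   ∀ {i j} → lookup xs i ≡ lookup xs j → i ≡ j
lookup-injective (_ ∷ _) {zero} {zero} _ = refl
lookup-injective (x∉xs ∷ _) {zero} {suc j} x≡ = ⊥-elim (All.lookup x∉xs (∈ₗ.∈-lookup j) x≡)
lookup-injective (x∉xs ∷ _) {suc i} {zero} ≡x = ⊥-elim (All.lookup x∉xs (∈ₗ.∈-lookup i) (sym ≡x))
lookup-injective (_ ∷ xs!) {suc i} {suc j} eq = cong suc (lookup-injective xs! eq)

length-concat-tabulate : ∀ {A : Set} {m k} (f : Fin m → List A) → (∀ i → length (f i) ≡ k) →
                         length (L.concat (tabulate f)) ≡ m * k
length-concat-tabulate {m = zero} f len = refl
length-concat-tabulate {m = suc m} f len =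
  trans (LP.length-++ (f zero))
        (cong₂ _+_ (len zero) (length-concat-tabulate (f ∘ suc) (len ∘ suc)))

nonempty-of-length : ∀ {xs : List ℕ} {k} → length xs ≡ suc k → ∃ (_∈ₗ xs)
nonempty-of-length {y ∷ _} _ = y , here refl

shrink-avoiding : ∀ {k} x {xs : List ℕ} → Unique xs → length xs ≡ suc k →
                  ∃ λ ys → Unique ys × length ys ≡ k × ys ⊆ₗ xs × x ∉ₗ ys
shrink-avoiding x {y ∷ ys} (y∉ys ∷ ys!) len with x ≟ y
... | yes refl = ys , ys! , ℕ.suc-injective len , there , λ x∈ys → All.lookup y∉ys x∈ys refl
shrink-avoiding {zero} x {y ∷ ys} _ _ | no _ = [] , [] , refl , (λ ()) , λ ()
shrink-avoiding {suc k} x {y ∷ ys} (y∉ys ∷ ys!) len | no x≢y =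
  let (zs , zs! , len′ , zs⊆ys , x∉zs) = shrink-avoiding x ys! (ℕ.suc-injective len)
  in y ∷ zs , All.tabulate (All.lookup y∉ys ∘ zs⊆ys) ∷ zs! , cong suc len′ ,
     (λ { (here refl) → here refl ; (there z∈zs) → there (zs⊆ys z∈zs) }) ,
     (λ { (here x≡y) → x≢y x≡y ; (there x∈zs) → x∉zs x∈zs })

-- position x xs is length xs when x ∉ xs, and xs at i is 0 when i ≥ length xs.
position : ℕ → List ℕ → ℕ
position x [] = 0
position x (y ∷ ys) with x ≟ y
... | yes _ = 0
... | no _ = suc (position x ys)

_at_ : List ℕ → ℕ → ℕ
[] at _ = 0
(y ∷ ys) at zero = y
(y ∷ ys) at suc i = ys at i

position<length : ∀ {x} xs → x ∈ₗ xs → position x xs < length xs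
position<length {x} (y ∷ ys) x∈ with x ≟ y | x∈
... | yes _ | _ = s≤s z≤n
... | no x≢y | here x≡y = ⊥-elim (x≢y x≡y)
... | no _ | there x∈ys = s≤s (position<length ys x∈ys)

at-position : ∀ {x} xs → x ∈ₗ xs → xs at position x xs ≡ x
at-position {x} (y ∷ ys) x∈ with x ≟ y | x∈
... | yes x≡y | _ = sym x≡y
... | no x≢y | here x≡y = ⊥-elim (x≢y x≡y)
... | no _ | there x∈ys = at-position ys x∈ys

module Encoding {N} .{{_ : NonZero N}} (U : List ℕ) (U-short : length U ≤ N) where

  encode : ℕ → Fin N
  encode x = position x U mod N

  decode : Fin N → ℕ
  decode y = U at toℕ y

  decode-encode : ∀ {x} → x ∈ₗ U → decode (encode x) ≡ x
  decode-encode {x} x∈U = begin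
    U at toℕ (position x U mod N) ≡⟨ cong (U at_) (FP.toℕ-fromℕ< _) ⟩
    U at (position x U % N)        ≡⟨ cong (U at_) (m<n⇒m%n≡m position<N) ⟩
    U at position x U              ≡⟨ at-position U x∈U ⟩
    x                              ∎
    where
    open ≡-Reasoning
    position<N : position x U < N
    position<N = ≤-trans (position<length U x∈U) U-short

  image : List ℕ → Subset N
  image xs = fromList (map encode xs)

  ∈-image⁺ : ∀ {x xs} → x ∈ₗ xs → encode x ∈ image xs
  ∈-image⁺ = ∈-fromList⁺ ∘ ∈ₗ.∈-map⁺ encode

  ∈-image⁻ : ∀ {xs y} → xs ⊆ₗ U → y ∈ image xs → decode y ∈ₗ xs × encode (decode y) ≡ y
  ∈-image⁻ {xs} xs⊆U y∈ =
    let (x , x∈xs , y≡x) = ∈ₗ.∈-map⁻ encode (∈-fromList⁻ (map encode xs) y∈)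
        decode-y≡x = trans (cong decode y≡x) (decode-encode (xs⊆U x∈xs))
    in subst (_∈ₗ xs) (sym decode-y≡x) x∈xs , trans (cong encode decode-y≡x) (sym y≡x)

  ∣image∣≡length : ∀ {xs} → xs ⊆ₗ U → Unique xs → ∣ image xs ∣ ≡ length xs
  ∣image∣≡length {xs} xs⊆U xs! =
    trans (∣fromList∣≡length (Unique.map⁻ (subst Unique (sym decode∘encode-id) xs!)))
          (length-map encode xs)
    where
    decode∘encode-id : map decode (map encode xs) ≡ xs
    decode∘encode-id =
      trans (sym (LP.map-∘ xs)) (LP.map-id-local (All.tabulate (decode-encode ∘ xs⊆U)))

-- Sub-hypergraphs, transversals and covers


subFamily? : ∀ {c} {R : Hypergraph N} → Decidable R →
             {X : (Fin c → Subset N) → Set} → X Respects _≗_ → Decidable X →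
             Dec (Σ (SubFamily R c) (X ∘ proj₁))
subFamily? {N = N} {c} {R} R? {X} X-resp X? =
  map′ (λ { (E , (inj , r) , x) → (E , (λ {i j} → inj {i} {j}) , r) , x })
       (λ { ((E , inj , r) , x) → E , ((λ {i j} → inj {i} {j}) , r) , x })
       (search-Fin→ anySubset? c valid-resp (λ E → (injective? _≟ₛ_ E ×-dec all? (R? ∘ E)) ×-dec X? E))
  where
  Valid : (Fin c → Subset N) → Set
  Valid E = (Injective _≡_ _≡_ E × ∀ i → R (E i)) × X E
  valid-resp : Valid Respects _≗_
  valid-resp E≗E′ ((inj , r) , x) =
    ((λ eq → inj (trans (E≗E′ _) (trans eq (sym (E≗E′ _))))) , (λ i → subst R (E≗E′ i) (r i))) ,
    X-resp E≗E′ x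

subFamily-of-list : {R : Hypergraph N} (es : List (Subset N)) → All R es →
                    ∃ λ c → c ≤ length es × Σ (SubFamily R c) λ C →
                      ∀ {e} → e ∈ₗ es → ∃ λ i → proj₁ C i ≡ e
subFamily-of-list {N} es R-es =
  length ds , LP.length-deduplicate _≟ₛ_ es ,
  (lookup ds , lookup-injective (deduplicate-! _≟ₛ_ es) ,
   λ i → All.lookup R-es (∈ₗ.∈-deduplicate⁻ _≟ₛ_ es (∈ₗ.∈-lookup i))) ,
  λ e∈es → let e∈ds = ∈ₗ.∈-deduplicate⁺ _≟ₛ_ e∈es in Any.index e∈ds , sym (AnyP.lookup-index e∈ds)
  where
  ds : List (Subset N)
  ds = deduplicate _≟ₛ_ es

sized? : ∀ k → Decidable (Complete N k)
sized? k e = ∣ e ∣ ≟ k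

T? : (E : Fin m → Subset N) → Decidable (T E)
T? E e = (e ⊆? ⋃ (tabulate E)) ×-dec all? (λ i → nonempty? (e ∩ E i)) ×-dec (∣ e ∣ ≤? _)

T-resp : {E E′ : Fin m → Subset N} → E ≗ E′ → ∀ {e} → T E′ e → T E e
T-resp E≗E′ {e} (e⊆⋃ , meets , small) =
  subst (e ⊆_) (cong ⋃ (sym (LP.tabulate-cong E≗E′))) e⊆⋃ ,
  (λ i → subst (λ Ei → Nonempty (e ∩ Ei)) (sym (E≗E′ i)) (meets i)) ,
  small

transversal-of-choice : (E : Fin m → Subset N) (y : Fin m → Fin N) → (∀ i → y i ∈ E i) →
                        T E (fromList (tabulate y))
transversal-of-choice E y y∈E =
  (λ z∈ → let (i , z≡yi) = ∈ₗ.∈-tabulate⁻ (∈-fromList⁻ (tabulate y) z∈)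
          in ∈-⋃⁺ (AnyP.tabulate⁺ i (subst (_∈ E i) (sym z≡yi) (y∈E i)))) ,
  (λ i → y i , SP.x∈p∩q⁺ (∈-fromList⁺ (∈ₗ.∈-tabulate⁺ i) , y∈E i)) ,
  ≤-trans (∣fromList∣≤length (tabulate y)) (≤-reflexive (length-tabulate y))

Covers : ∀ {c} → (Fin c → Subset N) → Hypergraph N → Set
Covers C H = ∀ e → H e → ∃[ i ] (C i ⊆ e)

covers-or-escapes : ∀ {c} {H : Hypergraph N} → Decidable H → (C : Fin c → Subset N) →
                    Covers C H ⊎ ∃ λ e → H e × ∀ i → C i ⊈ e
covers-or-escapes H? C with anySubset? (λ e → H? e ×-dec all? (λ i → ¬? (C i ⊆? e)))
... | yes escape = inj₂ escape
... | no ¬escape = inj₁ λ e h →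
  let (i , ¬¬C⊆e) = FP.¬∀⟶∃¬ _ _ (λ i → ¬? (C i ⊆? e)) (λ C⊈e → ¬escape (e , h , C⊈e))
  in i , decidable-stable (C i ⊆? e) ¬¬C⊆e

covers? : ∀ {c} {H : Hypergraph N} → Decidable H → (C : Fin c → Subset N) → Dec (Covers C H)
covers? H? C with covers-or-escapes H? C
... | inj₁ cov = yes cov
... | inj₂ (e , h , C⊈e) = no λ cov → let (i , C⊆e) = cov e h in C⊈e i C⊆e

TCoverable : (N k m c : ℕ) → Set
TCoverable N k m c = Σ (SubFamily (Complete N k) m) λ R′ → Cover (Complete N k) (T (proj₁ R′)) c

tCoverable? : ∀ N k m c → Dec (TCoverable N k m c)
tCoverable? N k m c = subFamily? (sized? k) T-cover-resp λ E →
                      subFamily? (sized? k) covers-resp (covers? (T? E))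
  where
  T-cover-resp : (λ E → Cover (Complete N k) (T E) c) Respects _≗_
  T-cover-resp E≗E′ (C , cov) = C , λ e t → cov e (T-resp E≗E′ t)
  covers-resp : ∀ {H : Hypergraph N} → (λ (C : Fin c → Subset N) → Covers C H) Respects _≗_
  covers-resp C≗C′ cov e h = let (i , C⊆e) = cov e h in i , subst (_⊆ e) (C≗C′ i) C⊆e

¬tCoverable-zero : ∀ {N k m} .{{_ : NonZero k}} → ¬ TCoverable N k m 0
¬tCoverable-zero {N} {k} {m} ((E , _ , E-size) , _ , covers)
  with covers _ (transversal-of-choice E _ (proj₂ ∘ chosen))
  where
  chosen : ∀ i → Nonempty (E i)
  chosen i = nonempty (E i) (subst (1 ≤_) (sym (E-size i)) (>-nonZero⁻¹ k))
... | () , _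

module Blocks {m k} .{{_ : NonZero k}} (k≤m : k ≤ m) where

  block : Fin m → Subset (m * k)
  block i = fromList (tabulate (F.combine i))

  ∈-block⁻ : ∀ {i y} → y ∈ block i → ∃ λ r → y ≡ F.combine i r
  ∈-block⁻ {i} = ∈ₗ.∈-tabulate⁻ ∘ ∈-fromList⁻ (tabulate (F.combine i))

  block-size : ∀ i → ∣ block i ∣ ≡ k
  block-size i =
    trans (∣fromList∣≡length (Unique.tabulate⁺ {f = F.combine {n = k} i} (FP.combine-injectiveʳ i _ i _)))
          (length-tabulate (F.combine {n = k} i))

  block-injective : Injective _≡_ _≡_ block
  block-injective {i} {j} bi≡bj =
    let r₀ = F.fromℕ< (>-nonZero⁻¹ k)
        (r , eq) = ∈-block⁻ (subst (F.combine i r₀ ∈_) bi≡bj (∈-fromList⁺ (∈ₗ.∈-tabulate⁺ r₀)))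
    in FP.combine-injectiveˡ i r₀ j r eq

  transversal-contains-k-set : ∀ e → T block e → ∃ λ s → ∣ s ∣ ≡ k × s ⊆ e
  transversal-contains-k-set e (_ , meets , _) = s , s-size , s⊆e
    where
    y : Fin m → Fin (m * k)
    y i = proj₁ (meets i)
    y∈ : ∀ i → y i ∈ e × y i ∈ block i
    y∈ i = SP.x∈p∩q⁻ e (block i) (proj₂ (meets i))
    y-injective : Injective _≡_ _≡_ y
    y-injective {i} {j} yi≡yj =
      let (r , yi≡) = ∈-block⁻ (proj₂ (y∈ i))
          (r′ , yj≡) = ∈-block⁻ (proj₂ (y∈ j))
      in FP.combine-injectiveˡ i r j r′ (trans (sym yi≡) (trans yi≡yj yj≡))
    y≤k : Fin k → Fin (m * k)
    y≤k r = y (F.inject≤ r k≤m)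
    s : Subset (m * k)
    s = fromList (tabulate y≤k)
    s-size : ∣ s ∣ ≡ k
    s-size =
      trans (∣fromList∣≡length (Unique.tabulate⁺ (FP.inject≤-injective k≤m k≤m _ _ ∘ y-injective)))
            (length-tabulate y≤k)
    s⊆e : s ⊆ e
    s⊆e z∈s = let (r , z≡) = ∈ₗ.∈-tabulate⁻ (∈-fromList⁻ (tabulate y≤k) z∈s)
              in subst (_∈ e) (sym z≡) (proj₁ (y∈ _))

tCoverable-exists : ∀ {m k} .{{_ : NonZero k}} → k ≤ m → ∃ (TCoverable (m * k) k m)
tCoverable-exists {m} {k} k≤m =
  let (c , _ , C , complete) =
        subFamily-of-list (filter (sized? k) (subsets (m * k))) (AllP.all-filter (sized? k) (subsets (m * k)))
  in c , (block , block-injective , block-size) , C , λ e Te →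
       let (s , s-size , s⊆e) = transversal-contains-k-set e Te
           (i , Ci≡s) = complete (∈ₗ.∈-filter⁺ (sized? k) (∈-subsets s) s-size)
       in i , subst (_⊆ e) (sym Ci≡s) s⊆e
  where open Blocks k≤m

LeastTCover : (N k m n : ℕ) → Set
LeastTCover N k m n = TCoverable N k m n × ∀ c → TCoverable N k m c → n ≤ c

leastTCover-exists : ∀ {m k} .{{_ : NonZero k}} → k ≤ m → ∃ (LeastTCover (m * k) k m)
leastTCover-exists k≤m = minimalℕ (tCoverable? _ _ _) (proj₂ (tCoverable-exists k≤m))

leastTCover-positive : ∀ {N k m n} .{{_ : NonZero k}} → LeastTCover N k m n → 1 ≤ n
leastTCover-positive {n = zero} (cover , _) = ⊥-elim (¬tCoverable-zero cover)
leastTCover-positive {n = suc _} _ = s≤s z≤n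

-- List colourings

shrinkAssignment : ∀ {G k} (L : ListAssignment G (suc k)) (avoid : V G → ℕ) →
                   Σ (ListAssignment G k) λ L′ →
                     ∀ v → proj₁ L′ v ⊆ₗ proj₁ L v × avoid v ∉ₗ proj₁ L′ v
shrinkAssignment {G} {k} (L , L! , len) avoid =
  ((λ v → proj₁ (s v)) , (λ v → proj₁ (proj₂ (s v))) , (λ v → proj₁ (proj₂ (proj₂ (s v))))) ,
  (λ v → proj₂ (proj₂ (proj₂ (s v))))
  where
  s : ∀ v → ∃ λ ys → Unique ys × length ys ≡ k × ys ⊆ₗ L v × avoid v ∉ₗ ys
  s v = shrink-avoiding (avoid v) (L! v) (len v)

choosable-suc : ∀ {G k} → Choosable G k → Choosable G (suc k)
choosable-suc {G} choosable L =
  let (L′ , L′⊆L) = shrinkAssignment {G} L (λ _ → 0)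
      (colour , colour∈L′ , proper) = choosable L′
  in colour , (λ v → proj₁ (L′⊆L v) (colour∈L′ v)) , proper

choosable-mono : ∀ {G k k′} → k ≤ k′ → Choosable G k → Choosable G k′
choosable-mono k≤k′ = mono (ℕ.≤⇒≤′ k≤k′)
  where
  mono : ∀ {G k k′} → k ≤′ k′ → Choosable G k → Choosable G k′
  mono ≤′-refl choosable = choosable
  mono (≤′-step k≤′k′) choosable = choosable-suc (mono k≤′k′ choosable)

K-proper : ∀ {m n} (colour : Fin m ⊎ Fin n → ℕ) → (∀ i j → colour (inj₁ i) ≢ colour (inj₂ j)) →
           ∀ u v → Adj (K m n) u v → colour u ≢ colour v
K-proper colour sep (inj₁ i) (inj₂ j) _ = sep i j
K-proper colour sep (inj₂ j) (inj₁ i) _ = sep i j ∘ sym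

-- The new large vertex takes a colour x₀ of its list, and x₀ is removed from all other lists.
K-choosable-suc : ∀ {m n k} → Choosable (K m n) k → Choosable (K m (suc n)) (suc k)
K-choosable-suc {m} {n} {k} choosable L@(lists , _ , len) = extend (choosable L″)
  where
  x₀∈L : ∃ (_∈ₗ lists (inj₂ zero))
  x₀∈L = nonempty-of-length (len (inj₂ zero))
  x₀ : ℕ
  x₀ = proj₁ x₀∈L
  shrunk : Σ (ListAssignment (K m (suc n)) k) λ L′ →
             ∀ v → proj₁ L′ v ⊆ₗ lists v × x₀ ∉ₗ proj₁ L′ v
  shrunk = shrinkAssignment {K m (suc n)} L (λ _ → x₀)
  L′ : ListAssignment (K m (suc n)) k
  L′ = proj₁ shrunk
  old : Fin m ⊎ Fin n → Fin m ⊎ Fin (suc n)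
  old = Sum.map₂ suc
  L″ : ListAssignment (K m n) k
  L″ = proj₁ L′ ∘ old , proj₁ (proj₂ L′) ∘ old , proj₂ (proj₂ L′) ∘ old
  extend : ProperLColoring (K m n) L″ → ProperLColoring (K m (suc n)) L
  extend (c′ , c′∈L″ , proper′) = colour , colour∈L , K-proper colour sep
    where
    colour : Fin m ⊎ Fin (suc n) → ℕ
    colour (inj₁ i) = c′ (inj₁ i)
    colour (inj₂ zero) = x₀
    colour (inj₂ (suc j)) = c′ (inj₂ j)
    colour∈L : ∀ v → colour v ∈ₗ lists v
    colour∈L (inj₁ i) = proj₁ (proj₂ shrunk (inj₁ i)) (c′∈L″ (inj₁ i))
    colour∈L (inj₂ zero) = proj₂ x₀∈L
    colour∈L (inj₂ (suc j)) = proj₁ (proj₂ shrunk (inj₂ (suc j))) (c′∈L″ (inj₂ j))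
    sep : ∀ i j → colour (inj₁ i) ≢ colour (inj₂ j)
    sep i zero c′≡x₀ =
      proj₂ (proj₂ shrunk (inj₁ i)) (subst (_∈ₗ proj₁ L′ (inj₁ i)) c′≡x₀ (c′∈L″ (inj₁ i)))
    sep i (suc j) = proper′ (inj₁ i) (inj₂ j) tt

colours : Subset N → List ℕ
colours p = map toℕ (elements p)

∈-colours⁻ : ∀ {p : Subset N} {x} → x ∈ₗ colours p → ∃ λ y → y ∈ p × x ≡ toℕ y
∈-colours⁻ x∈ = let (y , y∈ , x≡y) = ∈ₗ.∈-map⁻ toℕ x∈ in y , ∈-elements⁻ y∈ , x≡y

edgeAssignment : ∀ {N m n k} (E : Fin m → Subset N) (C : Fin n → Subset N) →
                 (∀ i → ∣ E i ∣ ≡ k) → (∀ j → ∣ C j ∣ ≡ k) → ListAssignment (K m n) k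
edgeAssignment {N} {m} {n} {k} E C E-size C-size =
  colours ∘ edge ,
  (λ v → Unique.map⁺ FP.toℕ-injective (elements-unique (edge v))) ,
  (λ v → trans (length-map toℕ (elements (edge v)))
               (trans (length-elements (edge v)) (edge-size v)))
  where
  edge : Fin m ⊎ Fin n → Subset N
  edge = Sum.[ E , C ]′
  edge-size : ∀ v → ∣ edge v ∣ ≡ k
  edge-size (inj₁ i) = E-size i
  edge-size (inj₂ j) = C-size j

¬choosable-of-tCover : ∀ {N k m n} → TCoverable N k m n → ¬ Choosable (K m n) k
¬choosable-of-tCover {N} {k} {m} {n} ((E , _ , E-size) , (C , _ , C-size) , covers) choosable =
  conflict (choosable (edgeAssignment E C E-size C-size))
  where
  conflict : ¬ ProperLColoring (K m n) (edgeAssignment E C E-size C-size)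
  conflict (colour , colour∈ , proper) =
    let (j , Cj⊆e) = covers _ (transversal-of-choice E y (proj₁ ∘ proj₂ ∘ chosen))
        (z , z∈Cj , bj≡z) = ∈-colours⁻ (colour∈ (inj₂ j))
        (i , z≡yi) = ∈ₗ.∈-tabulate⁻ (∈-fromList⁻ (tabulate y) (Cj⊆e z∈Cj))
    in proper (inj₁ i) (inj₂ j) tt
              (trans (proj₂ (proj₂ (chosen i))) (trans (cong toℕ (sym z≡yi)) (sym bj≡z)))
    where
    chosen : ∀ i → ∃ λ y → y ∈ E i × colour (inj₁ i) ≡ toℕ y
    chosen i = ∈-colours⁻ (colour∈ (inj₁ i))
    y : Fin m → Fin N
    y = proj₁ ∘ chosen

SmallSideDistinct : ∀ {m n} → (Fin m ⊎ Fin n → List ℕ) → Set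
SmallSideDistinct L = ∀ i j → L (inj₁ i) ⊆ₗ L (inj₁ j) → L (inj₁ j) ⊆ₗ L (inj₁ i) → i ≡ j

-- A small-side list with the same set as an earlier one is replaced by k fresh colours above
-- all colours in use; the original vertex is then coloured like the first vertex with that set.
module Distinguish {m n k} .{{_ : NonZero k}} (L : ListAssignment (K m n) k) where

  A : Fin m → List ℕ
  A i = proj₁ L (inj₁ i)

  Same : Fin m → Fin m → Set
  Same i j = A i ⊆ₗ A j × A j ⊆ₗ A i

  same-trans : ∀ {i j l} → Same i j → Same j l → Same i l
  same-trans (i⊆j , j⊆i) (j⊆l , l⊆j) = ⊆ₗ-trans i⊆j j⊆l , ⊆ₗ-trans l⊆j j⊆i

  first : ∀ i → ∃ λ f → Same f i × ∀ j → Same j i → toℕ f ≤ toℕ j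
  first i = minimalFin (λ j → (A j ⊆ₗ? A i) ×-dec (A i ⊆ₗ? A j)) {i} (⊆ₗ-refl , ⊆ₗ-refl)

  rep : Fin m → Fin m
  rep i = proj₁ (first i)

  rep-same : ∀ i → Same (rep i) i
  rep-same i = proj₁ (proj₂ (first i))

  rep-least : ∀ i j → Same j i → toℕ (rep i) ≤ toℕ j
  rep-least i = proj₂ (proj₂ (first i))

  rep-idem : ∀ i → rep (rep i) ≡ rep i
  rep-idem i = FP.toℕ-injective (ℕ.≤-antisym
    (rep-least (rep i) (rep i) (⊆ₗ-refl , ⊆ₗ-refl))
    (rep-least i (rep (rep i)) (same-trans (rep-same (rep i)) (rep-same i))))

  bound : ℕ
  bound = suc (max 0 (L.concat (tabulate A)))

  A<bound : ∀ i {x} → x ∈ₗ A i → x < bound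
  A<bound i x∈ = s≤s (All.lookup (xs≤max 0 _) (∈ₗ.∈-concat⁺′ x∈ (∈ₗ.∈-tabulate⁺ i)))

  freshColour : Fin m → Fin k → ℕ
  freshColour i r = bound + toℕ (F.combine i r)

  freshColour-injective : ∀ {i j r s} → freshColour i r ≡ freshColour j s → F.combine i r ≡ F.combine j s
  freshColour-injective eq = FP.toℕ-injective (ℕ.+-cancelˡ-≡ bound _ _ eq)

  fresh : Fin m → List ℕ
  fresh i = tabulate (freshColour i)

  r₀ : Fin k
  r₀ = F.fromℕ< (>-nonZero⁻¹ k)

  fresh⊈A : ∀ i j → fresh i ⊆ₗ A j → ⊥
  fresh⊈A i j fresh⊆A = ℕ.m+n≮m bound _ (A<bound j (fresh⊆A (∈ₗ.∈-tabulate⁺ r₀)))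

  fresh-injective : ∀ i j → fresh i ⊆ₗ fresh j → i ≡ j
  fresh-injective i j fresh⊆fresh =
    let (r , eq) = ∈ₗ.∈-tabulate⁻ (fresh⊆fresh (∈ₗ.∈-tabulate⁺ r₀))
    in FP.combine-injectiveˡ i r₀ j r (freshColour-injective eq)

  small : ∀ i → Dec (rep i ≡ i) → List ℕ
  small i (yes _) = A i
  small i (no _) = fresh i

  small-valid : ∀ i d → Unique (small i d) × length (small i d) ≡ k
  small-valid i (yes _) = proj₁ (proj₂ L) (inj₁ i) , proj₂ (proj₂ L) (inj₁ i)
  small-valid i (no _) =
    Unique.tabulate⁺ (FP.combine-injectiveʳ i _ i _ ∘ freshColour-injective) , length-tabulate _

  small-distinct : ∀ i j di dj → small i di ⊆ₗ small j dj → small j dj ⊆ₗ small i di → i ≡ j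
  small-distinct i j (yes ri≡i) (yes rj≡j) i⊆j j⊆i = FP.toℕ-injective (ℕ.≤-antisym
    (subst (λ r → toℕ r ≤ toℕ j) ri≡i (rep-least i j (j⊆i , i⊆j)))
    (subst (λ r → toℕ r ≤ toℕ i) rj≡j (rep-least j i (i⊆j , j⊆i))))
  small-distinct i j (yes _) (no _) _ j⊆i = ⊥-elim (fresh⊈A j i j⊆i)
  small-distinct i j (no _) (yes _) i⊆j _ = ⊥-elim (fresh⊈A i j i⊆j)
  small-distinct i j (no _) (no _) i⊆j _ = fresh-injective i j i⊆j

  small-rep : ∀ i d → small (rep i) d ≡ A (rep i)
  small-rep i (yes _) = refl
  small-rep i (no rri≢ri) = ⊥-elim (rri≢ri (rep-idem i))

  lists′ : Fin m ⊎ Fin n → List ℕ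
  lists′ (inj₁ i) = small i (rep i FP.≟ i)
  lists′ (inj₂ j) = proj₁ L (inj₂ j)

  L′ : ListAssignment (K m n) k
  L′ = lists′ , proj₁ ∘ valid , proj₂ ∘ valid
    where
    valid : ∀ v → Unique (lists′ v) × length (lists′ v) ≡ k
    valid (inj₁ i) = small-valid i (rep i FP.≟ i)
    valid (inj₂ j) = proj₁ (proj₂ L) (inj₂ j) , proj₂ (proj₂ L) (inj₂ j)

  L′-distinct : SmallSideDistinct lists′
  L′-distinct i j = small-distinct i j (rep i FP.≟ i) (rep j FP.≟ j)

  colouring : ProperLColoring (K m n) L′ → ProperLColoring (K m n) L
  colouring (c′ , c′∈L′ , proper′) = colour , colour∈L , K-proper colour sep
    where
    colour : Fin m ⊎ Fin n → ℕ
    colour (inj₁ i) = c′ (inj₁ (rep i))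
    colour (inj₂ j) = c′ (inj₂ j)
    colour∈L : ∀ v → colour v ∈ₗ proj₁ L v
    colour∈L (inj₁ i) = proj₁ (rep-same i)
      (subst (colour (inj₁ i) ∈ₗ_) (small-rep i (rep (rep i) FP.≟ rep i)) (c′∈L′ (inj₁ (rep i))))
    colour∈L (inj₂ j) = c′∈L′ (inj₂ j)
    sep : ∀ i j → colour (inj₁ i) ≢ colour (inj₂ j)
    sep i j = proper′ (inj₁ (rep i)) (inj₂ j) tt

choosable-of-distinct : ∀ {m n k} .{{_ : NonZero k}} →
  (∀ (L : ListAssignment (K m n) k) → SmallSideDistinct (proj₁ L) → ProperLColoring (K m n) L) →
  Choosable (K m n) k
choosable-of-distinct colour L = colouring (colour L′ L′-distinct)
  where open Distinguish L

module ColouringWithoutCover {m n k} .{{_ : NonZero (m * k)}}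
  (L : ListAssignment (K m n) k) (distinct : SmallSideDistinct (proj₁ L)) where

  A : Fin m → List ℕ
  A i = proj₁ L (inj₁ i)

  B : Fin n → List ℕ
  B j = proj₁ L (inj₂ j)

  unique : ∀ v → Unique (proj₁ L v)
  unique = proj₁ (proj₂ L)

  len : ∀ v → length (proj₁ L v) ≡ k
  len = proj₂ (proj₂ L)

  U : List ℕ
  U = L.concat (tabulate A)

  A⊆U : ∀ i → A i ⊆ₗ U
  A⊆U i x∈ = ∈ₗ.∈-concat⁺′ x∈ (∈ₗ.∈-tabulate⁺ i)

  open Encoding U (≤-reflexive (length-concat-tabulate A (len ∘ inj₁)))

  E : Fin m → Subset (m * k)
  E i = image (A i)

  E-size : ∀ i → ∣ E i ∣ ≡ k
  E-size i = trans (∣image∣≡length (A⊆U i) (unique (inj₁ i))) (len (inj₁ i))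

  E-injective : Injective _≡_ _≡_ E
  E-injective {i} {j} Ei≡Ej = distinct i j (A-⊆ Ei≡Ej) (A-⊆ (sym Ei≡Ej))
    where
    A-⊆ : ∀ {i j} → E i ≡ E j → A i ⊆ₗ A j
    A-⊆ {i} {j} Ei≡Ej {x} x∈Ai =
      subst (_∈ₗ A j) (decode-encode (A⊆U i x∈Ai))
            (proj₁ (∈-image⁻ (A⊆U j) (subst (encode x ∈_) Ei≡Ej (∈-image⁺ x∈Ai))))

  D : Fin n → Subset (m * k)
  D j = image (B j)

  -- A large list with no free colour would consist of colours decode (ψ i), so its image
  -- would lie inside e.
  colouring-of-escape : ∀ e → T E e → (∀ j → ∣ D j ∣ ≡ k → D j ⊈ e) → ProperLColoring (K m n) L
  colouring-of-escape e (_ , meets , _) D⊈e = colour , colour∈L , K-proper colour sep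
    where
    ψ : Fin m → Fin (m * k)
    ψ i = proj₁ (meets i)
    ψ∈e : ∀ i → ψ i ∈ e
    ψ∈e i = proj₁ (SP.x∈p∩q⁻ e (E i) (proj₂ (meets i)))
    decoded : ∀ i → decode (ψ i) ∈ₗ A i × encode (decode (ψ i)) ≡ ψ i
    decoded i = ∈-image⁻ (A⊆U i) (proj₂ (SP.x∈p∩q⁻ e (E i) (proj₂ (meets i))))
    a : Fin m → ℕ
    a i = decode (ψ i)

    free : ∀ j → Any (λ x → ∀ i → x ≢ a i) (B j)
    free j = decidable-stable (Any.any? (λ x → all? (λ i → ¬? (x ≟ a i))) (B j))
                              (λ none → D⊈e j (Dj-size none) (Dj⊆e none))
      where
      used : ¬ Any (λ x → ∀ i → x ≢ a i) (B j) → All (λ x → ∃ λ i → x ≡ a i) (B j)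
      used none = All.map (λ {x} x-unused →
                            let (i , ¬x≢ai) = FP.¬∀⟶∃¬ _ _ (λ i → ¬? (x ≟ a i)) x-unused
                            in i , decidable-stable (x ≟ a i) ¬x≢ai)
                          (AllP.¬Any⇒All¬ (B j) none)
      Bj⊆U : ¬ Any (λ x → ∀ i → x ≢ a i) (B j) → B j ⊆ₗ U
      Bj⊆U none x∈Bj = let (i , x≡ai) = All.lookup (used none) x∈Bj
                       in subst (_∈ₗ U) (sym x≡ai) (A⊆U i (proj₁ (decoded i)))
      Dj-size : ¬ Any (λ x → ∀ i → x ≢ a i) (B j) → ∣ D j ∣ ≡ k
      Dj-size none = trans (∣image∣≡length (Bj⊆U none) (unique (inj₂ j))) (len (inj₂ j))
      Dj⊆e : ¬ Any (λ x → ∀ i → x ≢ a i) (B j) → D j ⊆ e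
      Dj⊆e none {y} y∈Dj =
        let (dy∈Bj , encode-dy≡y) = ∈-image⁻ (Bj⊆U none) y∈Dj
            (i , dy≡ai) = All.lookup (used none) dy∈Bj
            ψi≡y = trans (sym (proj₂ (decoded i))) (trans (cong encode (sym dy≡ai)) encode-dy≡y)
        in subst (_∈ e) ψi≡y (ψ∈e i)

    colour : Fin m ⊎ Fin n → ℕ
    colour (inj₁ i) = a i
    colour (inj₂ j) = proj₁ (find (free j))
    colour∈L : ∀ v → colour v ∈ₗ proj₁ L v
    colour∈L (inj₁ i) = proj₁ (decoded i)
    colour∈L (inj₂ j) = proj₁ (proj₂ (find (free j)))
    sep : ∀ i j → colour (inj₁ i) ≢ colour (inj₂ j)
    sep i j = proj₂ (proj₂ (find (free j))) i ∘ sym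

  large-edges : List (Subset (m * k))
  large-edges = filter (sized? k) (tabulate D)

  colouring : (∀ c → c ≤ n → ¬ TCoverable (m * k) k m c) → ProperLColoring (K m n) L
  colouring noCover with subFamily-of-list large-edges (AllP.all-filter (sized? k) (tabulate D))
  ... | c , c≤ , C , C-complete with covers-or-escapes (T? E) (proj₁ C)
  ...   | inj₁ covers = ⊥-elim (noCover c c≤n ((E , E-injective , E-size) , C , covers))
    where
    c≤n : c ≤ n
    c≤n = ≤-trans c≤ (≤-trans (LP.length-filter (sized? k) (tabulate D))
                             (≤-reflexive (length-tabulate D)))
  ...   | inj₂ (e , Te , C⊈e) = colouring-of-escape e Te λ j Dj-size Dj⊆e →
    let (i , Ci≡Dj) = C-complete (∈ₗ.∈-filter⁺ (sized? k) (∈ₗ.∈-tabulate⁺ j) Dj-size)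
    in C⊈e i (subst (_⊆ e) (sym Ci≡Dj) Dj⊆e)

choosable-of-no-tCover : ∀ {m n k} .{{_ : NonZero m}} .{{_ : NonZero k}} →
  (∀ c → c ≤ n → ¬ TCoverable (m * k) k m c) → Choosable (K m n) k
choosable-of-no-tCover {m} {n} {k} noCover = choosable-of-distinct λ L distinct →
  ColouringWithoutCover.colouring {{ℕ.m*n≢0 m k}} L distinct noCover

-- The least cover size is n_m

choosable-below-leastTCover : ∀ {m k n n′} .{{_ : NonZero m}} .{{_ : NonZero k}} →
  LeastTCover (m * k) k m n → n′ < n → Choosable (K m n′) k
choosable-below-leastTCover (_ , least) n′<n =
  choosable-of-no-tCover λ c c≤n′ cover → ℕ.<⇒≱ n′<n (≤-trans (least c cover) c≤n′)

chIs-at-leastTCover : ∀ {m k n} .{{_ : NonZero m}} .{{_ : NonZero k}} →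
  LeastTCover (m * k) k m n → ChIs (K m n) (suc k)
chIs-at-leastTCover {n = zero} (cover , _) = ⊥-elim (¬tCoverable-zero cover)
chIs-at-leastTCover {n = suc _} least@(cover , _) =
  K-choosable-suc (choosable-below-leastTCover least ≤-refl) ,
  λ k′ choosable → ℕ.≰⇒> λ k′≤k → ¬choosable-of-tCover cover (choosable-mono k′≤k choosable)

leastTCover-minimal : ∀ {m k n} .{{_ : NonZero m}} .{{_ : NonZero k}} →
  LeastTCover (m * k) k m n → ∀ n′ → ChIs (K m n′) (suc k) → n ≤ n′
leastTCover-minimal {k = k} least n′ (_ , minimal) =
  ℕ.≮⇒≥ λ n′<n → ℕ.1+n≰n (minimal k (choosable-below-leastTCover least n′<n))

minCovIs-of-leastTCover : ∀ {m n} → LeastTCover (m * (m ∸ 2)) (m ∸ 2) m n → MinCovIs m n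
minCovIs-of-leastTCover ((R′ , cover) , least) =
  (R′ , cover , λ c cover′ → least c (R′ , cover′)) , λ R″ c (cover″ , _) → least c (R″ , cover″)

corollary1 : ∀ (m : ℕ) → 3 ≤ m → ∃[ n ] (IsNm m n × MinCovIs m n)
corollary1 _ (s≤s (s≤s (s≤s {n = j} z≤n))) =
  let (n , least) = leastTCover-exists (ℕ.m≤n+m (suc j) 2)
  in n , (leastTCover-positive least ,
          chIs-at-leastTCover least ,
          λ n′ _ → leastTCover-minimal least n′) ,
     minCovIs-of-leastTCover least
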